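{- Let $d\ge2$, $p$ a prime with $p\nmid d$, and $\mathbb{F}_q=\mathbb{F}_p(\mu_d)$. For each integer $e\ge1$, the set of dynatomic curves $X$ over $\mathbb{F}_q$ such that the morphism $X\to\mathbb{P}^1$ given by the coordinate $c$ has degree $e$ is finite.
   Context: Let $f=z^d+c$ viewed as a polynomial in $z$ over $\mathbb{F}_q[c]$, with iterates $f^n$ ($f^0(z)=z$). For nonnegative integers $n>m$, any irreducible factor of $f^n(z)-f^m(z)\in\mathbb{F}_q[z,c]$ defines a plane curve over $\mathbb{F}_q$; a dynatomic curve is any such curve (or its smooth projective model), two being different if the corresponding closed subschemes of $\mathbb{A}^2_{\mathbb{F}_q}$ differ. -}

module Defs where

open import Level using (Level; _⊔_)
open import Algebra.Bundles using (CommutativeRing)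
open import Data.Nat as ℕ using (ℕ; zero; suc; _∸_; _<_; _≤_)
open import Data.Fin using (Fin)
open import Data.List using (List; map; foldr)
open import Data.Product using (Σ; ∃; _×_)
open import Data.Sum using (_⊎_)
open import Relation.Nullary using (¬_; yes; no)
open import Relation.Binary.PropositionalEquality using (_≡_)

module Poly {a ℓ : Level} (K : CommutativeRing a ℓ) where
  open CommutativeRing K renaming (Carrier to R)

  IsField : Set (a ⊔ ℓ)
  IsField = (¬ (1# ≈ 0#)) × (∀ x → ¬ (x ≈ 0#) → ∃ λ y → x * y ≈ 1#)

  natMul : ℕ → R
  natMul zero = 0#
  natMul (suc n) = 1# + natMul n

  pow : R → ℕ → R
  pow x zero = 1#
  pow x (suc n) = x * pow x n

  sumL : List R → R
  sumL = foldr _+_ 0#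

  -- K = F_p(μ_d): characteristic p, K contains d distinct d-th roots of
  -- unity, and K is generated (as a ring, hence as a field since it is
  -- finite) by them; the subring generated by μ_d is the set of finite sums
  -- of elements of μ_d (μ_d is closed under products; -1 = (p-1)·1).
  HasCharacteristic : ℕ → Set ℓ
  HasCharacteristic p = natMul p ≈ 0#

  IsFpMuD : ℕ → Set (a ⊔ ℓ)
  IsFpMuD d = Σ (Fin d → R) λ ζ →
      (∀ i → pow (ζ i) d ≈ 1#)
    × (∀ i j → ζ i ≈ ζ j → i ≡ j)
    × (∀ x → ∃ λ (l : List (Fin d)) → x ≈ sumL (map ζ l))

  -- Raw bivariate coefficient arrays: g i j = coefficient of z^i c^j.
  Coeff : Set a
  Coeff = ℕ → ℕ → R

  IsPoly : Coeff → Set ℓ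
  IsPoly g = ∃ λ N → ∀ i j → N ≤ i ℕ.+ j → g i j ≈ 0#

  _≈P_ : Coeff → Coeff → Set ℓ
  g ≈P h = ∀ i j → g i j ≈ h i j

  sumTo : ℕ → (ℕ → R) → R
  sumTo zero f = 0#
  sumTo (suc n) f = f n + sumTo n f

  mono : ℕ → ℕ → Coeff
  mono k l i j with i ℕ.≟ k | j ℕ.≟ l
  ... | yes _ | yes _ = 1#
  ... | _     | _     = 0#

  oneP Z C : Coeff
  oneP = mono 0 0
  Z = mono 1 0
  C = mono 0 1

  _+P_ _-P_ _*P_ : Coeff → Coeff → Coeff
  (g +P h) i j = g i j + h i j
  (g -P h) i j = g i j - h i j
  (g *P h) i j = sumTo (suc i) λ s → sumTo (suc j) λ t → g s t * h (i ∸ s) (j ∸ t)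

  _^P_ : Coeff → ℕ → Coeff
  g ^P zero = oneP
  g ^P suc n = g *P (g ^P n)

  iter : ℕ → ℕ → Coeff
  iter d zero = Z
  iter d (suc n) = (iter d n ^P d) +P C

  _∣P_ : Coeff → Coeff → Set (a ⊔ ℓ)
  g ∣P h = ∃ λ k → IsPoly k × ((g *P k) ≈P h)

  IsUnit : Coeff → Set (a ⊔ ℓ)
  IsUnit g = g ∣P oneP

  Associated : Coeff → Coeff → Set (a ⊔ ℓ)
  Associated g h = (g ∣P h) × (h ∣P g)

  Irreducible : Coeff → Set (a ⊔ ℓ)
  Irreducible g = IsPoly g × (¬ IsUnit g)
    × (∀ u v → IsPoly u → IsPoly v → (u *P v) ≈P g → IsUnit u ⊎ IsUnit v)

  IsDynatomic : ℕ → Coeff → Set (a ⊔ ℓ)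
  IsDynatomic d g = Irreducible g
    × ∃ λ n → ∃ λ m → m < n × (g ∣P (iter d n -P iter d m))

  -- degree in z is exactly e (= degree of the coordinate map c : X → P^1)
  DegZ : Coeff → ℕ → Set ℓ
  DegZ g e = (∀ i j → e < i → g i j ≈ 0#) × ∃ λ j → ¬ (g e j ≈ 0#)

{-# OPTIONS --safe #-}

module Submission where

-- Give z weight 1 and c weight d, so that f = z^d + c is weighted homogeneous and fⁿ - fᵐ (n > m)
-- has weighted degree dⁿ, with z^(dⁿ) its largest monomial of top weight when monomials are
-- ordered by weight and then by z-degree. If g divides fⁿ - fᵐ, the leading monomials of g and of
-- the cofactor multiply to z^(dⁿ), so the leading monomial of g is a power of z. Hence the
-- weighted degree of g is its z-degree e, g lives in the box 0 ≤ i, j ≤ e, and since F_p(μ_d) is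
-- finite there are only finitely many such g.
--
-- Leading monomials exist only up to double negation; this suffices because x ≈ 0 is ¬¬-stable
-- in K, as some power x ↦ x^Q with Q ≥ 2 is the identity of K.

open import Defs
open import Algebra.Bundles using (CommutativeRing)
open import Data.Nat using (ℕ; _≤_)
open import Data.Nat.Divisibility using (_∣_)
open import Data.Nat.Primality using (Prime)
open import Data.List using (List)
open import Data.List.Relation.Unary.All using (All)
open import Data.List.Relation.Unary.Any using (Any)
open import Data.Product using (∃; _×_)
open import Relation.Nullary using (¬_)

open import Data.Nat.Base as ℕ using (_<_)
import Data.Nat.Properties as ℕ
open import Data.Nat.Primality using (prime⇒nonZero)
open import Data.Product using (_,_; proj₂)
open import Data.Sum using (_⊎_; inj₁; inj₂)
open import Relation.Nullary.Negation using (Stable)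

module Arithmetic where

  open import Data.Nat.Base using (zero; suc; _+_; _*_; _∸_; _^_; _<_; z≤n; s≤s; NonZero)
  open import Data.Nat.Properties
  open import Data.Nat.Coprimality using (Coprime; coprime-divisor)
  open import Data.Nat.Combinatorics using (_C_; nCk+nC[k+1]≡[n+1]C[k+1]; nC1≡n)
  open import Data.Nat.Combinatorics.Specification using (k>n⇒nCk≡0)
  open import Data.Nat.DivMod using (_%_; _/_; _mod_; m≡m%n+[m/n]*n; m%n<n)
  open import Data.Nat.Divisibility using (divides; ∣⇒≤)
  open import Data.Nat.Primality using (prime⇒irreducible; prime⇒nonZero; euclidsLemma)
  open import Data.Fin.Base using (toℕ)
  open import Data.Fin.Properties using (pigeonhole; toℕ-fromℕ<)
  open import Data.Product using (∃₂; _,_)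
  open import Data.Sum using (_⊎_; inj₁; inj₂)
  open import Relation.Nullary using (yes; no; contradiction)
  open import Relation.Binary.PropositionalEquality
    using (_≡_; refl; sym; trans; cong; cong₂; subst; module ≡-Reasoning)

  +-<⇒<⊎< : ∀ {m n o p} → m + n < o + p → m < o ⊎ n < p
  +-<⇒<⊎< {m} {n} {o} {p} m+n<o+p with m <? o | n <? p
  ... | yes m<o | _       = inj₁ m<o
  ... | no _    | yes n<p = inj₂ n<p
  ... | no m≮o  | no n≮p  = contradiction (+-mono-≤ (≮⇒≥ m≮o) (≮⇒≥ n≮p)) (<⇒≱ m+n<o+p)

  ¬¬-maximal : ∀ {a p} {A : Set a} (r : A → ℕ) (P : A → Set p) M → (∀ x → P x → r x ≤ M)
             → ∀ {x₀} → P x₀ → ¬ ¬ ∃ λ x → P x × r x₀ ≤ r x × (∀ y → r x < r y → ¬ P y)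
  ¬¬-maximal r P M bounded {x₀} Px₀ = climb (suc M) x₀ (m≤n+m (suc M) (r x₀)) Px₀ ≤-refl
    where
    climb : ∀ fuel x → M < r x + fuel → P x → r x₀ ≤ r x
          → ¬ ¬ ∃ λ x → P x × r x₀ ≤ r x × (∀ y → r x < r y → ¬ P y)
    climb zero x M<rx Px _ _ = <⇒≱ (subst (M <_) (+-identityʳ (r x)) M<rx) (bounded x Px)
    climb (suc fuel) x M<rx+1+f Px x₀≤x ¬goal = ¬goal (x , Px , x₀≤x , λ y rx<ry Py →
      climb fuel y (<-≤-trans (subst (M <_) (+-suc (r x) fuel) M<rx+1+f) (+-monoˡ-≤ fuel rx<ry))
                   Py (≤-trans x₀≤x (<⇒≤ rx<ry)) ¬goal)

  prime∤⇒coprime : ∀ {p d} → Prime p → ¬ p ∣ d → Coprime d p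
  prime∤⇒coprime pp p∤d (i∣d , i∣p) with prime⇒irreducible pp i∣p
  ... | inj₁ i≡1 = i≡1
  ... | inj₂ refl = contradiction i∣d p∤d

  coprime-divisor-^ : ∀ {d p} a {x} → Coprime d p → d ∣ p ^ a * x → d ∣ x
  coprime-divisor-^ {d} zero {x} _ d∣x = subst (d ∣_) (+-identityʳ x) d∣x
  coprime-divisor-^ {d} {p} (suc a) {x} cop d∣ =
    coprime-divisor-^ a cop (coprime-divisor cop (subst (d ∣_) (*-assoc p (p ^ a) x) d∣))

  %-≡⇒∣∸ : ∀ m n {d} .{{_ : NonZero d}} → m % d ≡ n % d → d ∣ m ∸ n
  %-≡⇒∣∸ m n {d} eq = divides (m / d ∸ n / d) (begin
    m ∸ n                                     ≡⟨ cong₂ _∸_ (m≡m%n+[m/n]*n m d) (m≡m%n+[m/n]*n n d) ⟩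
    (m % d + m / d * d) ∸ (n % d + n / d * d) ≡⟨ cong (λ r → (m % d + m / d * d) ∸ (r + n / d * d)) eq ⟨
    (m % d + m / d * d) ∸ (m % d + n / d * d) ≡⟨ [m+n]∸[m+o]≡n∸o (m % d) _ _ ⟩
    m / d * d ∸ n / d * d                     ≡⟨ *-distribʳ-∸ d (m / d) (n / d) ⟨
    (m / d ∸ n / d) * d                       ∎)
    where open ≡-Reasoning

  mod≡⇒%≡ : ∀ {m n d} .{{_ : NonZero d}} → m mod d ≡ n mod d → m % d ≡ n % d
  mod≡⇒%≡ {m} {n} {d} eq =
    trans (sym (toℕ-fromℕ< (m%n<n m d))) (trans (cong toℕ eq) (toℕ-fromℕ< (m%n<n n d)))

  p^a≡p^b⇒∣p^[b∸a]∸1 : ∀ {d p a b} .{{_ : NonZero d}} → Coprime d p → a ≤ b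
                      → p ^ a % d ≡ p ^ b % d → d ∣ p ^ (b ∸ a) ∸ 1
  p^a≡p^b⇒∣p^[b∸a]∸1 {d} {p} {a} {b} cop a≤b eq =
    coprime-divisor-^ a cop (subst (d ∣_) factor (%-≡⇒∣∸ (p ^ b) (p ^ a) (sym eq)))
    where
    open ≡-Reasoning
    factor : p ^ b ∸ p ^ a ≡ p ^ a * (p ^ (b ∸ a) ∸ 1)
    factor = begin
      p ^ b ∸ p ^ a                   ≡⟨ cong (λ n → p ^ n ∸ p ^ a) (m+[n∸m]≡n a≤b) ⟨
      p ^ (a + (b ∸ a)) ∸ p ^ a       ≡⟨ cong (_∸ p ^ a) (^-distribˡ-+-* p a (b ∸ a)) ⟩
      p ^ a * p ^ (b ∸ a) ∸ p ^ a     ≡⟨ cong (p ^ a * p ^ (b ∸ a) ∸_) (*-identityʳ (p ^ a)) ⟨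
      p ^ a * p ^ (b ∸ a) ∸ p ^ a * 1 ≡⟨ *-distribˡ-∸ (p ^ a) (p ^ (b ∸ a)) 1 ⟨
      p ^ a * (p ^ (b ∸ a) ∸ 1)       ∎

  -- By pigeonhole two of p⁰, …, pᵈ agree mod d.
  prime-power≡1-mod : ∀ d p .{{_ : NonZero d}} → Prime p → ¬ p ∣ d
                    → ∃₂ λ k r → p ^ suc k ≡ 1 + r * d
  prime-power≡1-mod d p pp p∤d with pigeonhole (n<1+n d) (λ i → (p ^ toℕ i) mod d)
  ... | i , j , i<j , eq with p^a≡p^b⇒∣p^[b∸a]∸1 (prime∤⇒coprime pp p∤d) (<⇒≤ i<j) (mod≡⇒%≡ eq)
  ... | divides r p^c∸1≡r*d = toℕ j ∸ toℕ i ∸ 1 , r , (begin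
    p ^ suc (c ∸ 1) ≡⟨ cong (p ^_) (m+[n∸m]≡n (m<n⇒0<n∸m i<j)) ⟩
    p ^ c           ≡⟨ m+[n∸m]≡n (m^n>0 p c) ⟨
    1 + (p ^ c ∸ 1) ≡⟨ cong (1 +_) p^c∸1≡r*d ⟩
    1 + r * d       ∎)
    where
    open ≡-Reasoning
    instance _ = prime⇒nonZero pp
    c : ℕ
    c = toℕ j ∸ toℕ i

  [k+1]*[n+1]C[k+1]≡[n+1]*nCk : ∀ n k → suc k * (suc n C suc k) ≡ suc n * (n C k)
  [k+1]*[n+1]C[k+1]≡[n+1]*nCk zero zero = refl
  [k+1]*[n+1]C[k+1]≡[n+1]*nCk zero (suc k)
    rewrite k>n⇒nCk≡0 {1} {suc (suc k)} (s≤s (s≤s z≤n)) | k>n⇒nCk≡0 {0} {suc k} (s≤s z≤n) =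
    *-zeroʳ (suc (suc k))
  [k+1]*[n+1]C[k+1]≡[n+1]*nCk (suc n) zero rewrite nC1≡n (suc (suc n)) =
    cong suc (trans (+-identityʳ _) (sym (*-identityʳ (suc n))))
  [k+1]*[n+1]C[k+1]≡[n+1]*nCk (suc n) (suc k) = begin
    (2 + k) * ((2 + n) C (2 + k))
      ≡⟨ cong ((2 + k) *_) (nCk+nC[k+1]≡[n+1]C[k+1] (suc n) (suc k)) ⟨
    (2 + k) * (A + B)
      ≡⟨ *-distribˡ-+ (2 + k) A B ⟩
    (A + (1 + k) * A) + (2 + k) * B
      ≡⟨ cong₂ (λ x y → (A + x) + y) ([k+1]*[n+1]C[k+1]≡[n+1]*nCk n k)
                                     ([k+1]*[n+1]C[k+1]≡[n+1]*nCk n (suc k)) ⟩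
    (A + (1 + n) * (n C k)) + (1 + n) * (n C suc k)
      ≡⟨ +-assoc A _ _ ⟩
    A + ((1 + n) * (n C k) + (1 + n) * (n C suc k))
      ≡⟨ cong (A +_) (*-distribˡ-+ (1 + n) (n C k) _) ⟨
    A + (1 + n) * (n C k + n C suc k)
      ≡⟨ cong (λ x → A + (1 + n) * x) (nCk+nC[k+1]≡[n+1]C[k+1] n k) ⟩
    (2 + n) * A
      ∎
    where
    open ≡-Reasoning
    A B : ℕ
    A = suc n C suc k
    B = suc n C suc (suc k)

  p∣pCk : ∀ {p k} → Prime p → 0 < k → k < p → p ∣ p C k
  p∣pCk {suc n} {suc k} pp _ k<p
    with euclidsLemma (suc k) (suc n C suc k) pp
           (divides (n C k) (trans ([k+1]*[n+1]C[k+1]≡[n+1]*nCk n k) (*-comm (suc n) (n C k))))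
  ... | inj₂ p∣pCk = p∣pCk
  ... | inj₁ p∣k+1 = contradiction (∣⇒≤ p∣k+1) (<⇒≱ k<p)

module Enumeration where

  open import Data.Nat.Base using (zero; suc)
  open import Data.Fin.Base using () renaming (zero to 0F; suc to 1+)
  open import Data.List.Base using ([_]; cartesianProductWith)
  open import Data.List.Relation.Unary.Any using (here)
  open import Data.List.Relation.Unary.Any.Properties using (cartesianProductWith⁺)
  open import Data.List.Relation.Unary.Enumerates.Setoid using (IsEnumeration)
  open import Data.Vec.Functional using (Vector; _∷_; head; tail)
  open import Data.Vec.Functional.Relation.Binary.Equality.Setoid using (_≋_; ≋-setoid)
  open import Relation.Binary.Bundles using (Setoid)

  allFunctions : ∀ {a} {A : Set a} → List A → ∀ n → List (Vector A n)
  allFunctions xs zero = [ (λ ()) ]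
  allFunctions xs (suc n) = cartesianProductWith _∷_ xs (allFunctions xs n)

  allFunctions⁺ : ∀ {a ℓ} (S : Setoid a ℓ) {xs} → IsEnumeration S xs
                → ∀ n → IsEnumeration (≋-setoid S n) (allFunctions xs n)
  allFunctions⁺ S xs-enum zero v = here (λ ())
  allFunctions⁺ S xs-enum (suc n) v =
    cartesianProductWith⁺ _∷_ cons-≋ (xs-enum (head v)) (allFunctions⁺ S xs-enum n (tail v))
    where
    open Setoid S using (_≈_)
    cons-≋ : ∀ {x w} → head v ≈ x → _≋_ S (tail v) w → _≋_ S v (x ∷ w)
    cons-≋ v₀≈x _ 0F = v₀≈x
    cons-≋ _ tail≋w (1+ i) = tail≋w i

module Frobenius {a ℓ} (K : CommutativeRing a ℓ) where

  open import Data.Nat.Base as ℕ using (zero; suc; s≤s; z≤n; NonZero)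
  import Data.Nat.Properties as ℕ
  open import Data.Nat.Combinatorics using (nCn≡1)
  open import Data.Nat.Divisibility using (divides)
  open import Data.Fin.Base using (Fin; fromℕ; inject₁) renaming (zero to 0F; suc to 1+)
  open import Data.Fin.Properties using (toℕ-inject₁; toℕ-fromℕ; toℕ<n)
  open import Relation.Binary.PropositionalEquality as ≡ using (_≡_)

  open CommutativeRing K renaming (Carrier to R)
  open Poly K using (pow; natMul; HasCharacteristic)
  open import Algebra.Properties.Semiring.Exp semiring using (_^_; ^-congˡ; ^-assocʳ)
  open import Algebra.Properties.Semiring.Mult semiring
    using (×-congʳ; ×-assoc-*; ×1-homo-*) renaming (_×_ to _·_)
  open import Algebra.Properties.Semiring.Sum semiring
    using (sum; sum-cong-≋; sum-replicate-zero; sum-init-last)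
  open import Algebra.Properties.CommutativeSemiring.Binomial commutativeSemiring
    using (theorem; binomialTerm)
  open import Relation.Binary.Reasoning.Setoid setoid
  open Arithmetic using (p∣pCk)

  pow≡^ : ∀ x n → pow x n ≡ x ^ n
  pow≡^ x zero = ≡.refl
  pow≡^ x (suc n) = ≡.cong (x *_) (pow≡^ x n)

  natMul≡·1 : ∀ n → natMul n ≡ n · 1#
  natMul≡·1 zero = ≡.refl
  natMul≡·1 (suc n) = ≡.cong (1# +_) (natMul≡·1 n)

  characteristic⇒p·1≈0 : ∀ p → HasCharacteristic p → p · 1# ≈ 0#
  characteristic⇒p·1≈0 p natMul-p≈0 = trans (reflexive (≡.sym (natMul≡·1 p))) natMul-p≈0

  1#^ : ∀ n → 1# ^ n ≈ 1#
  1#^ zero = refl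
  1#^ (suc n) = trans (*-identityˡ _) (1#^ n)

  0#^ : ∀ n .{{_ : NonZero n}} → 0# ^ n ≈ 0#
  0#^ (suc n) = zeroˡ _

  ·≈·1* : ∀ n x → n · x ≈ (n · 1#) * x
  ·≈·1* n x = trans (×-congʳ n (sym (*-identityˡ x))) (sym (×-assoc-* n 1# x))

  sum-zero : ∀ {n} (t : Fin n → R) → (∀ i → t i ≈ 0#) → sum t ≈ 0#
  sum-zero {n} t t≈0 = trans (sum-cong-≋ t≈0) (sum-replicate-zero n)

  ∣⇒·≈0 : ∀ {p n} x → p · 1# ≈ 0# → p ∣ n → n · x ≈ 0#
  ∣⇒·≈0 {p} x p·1≈0 (divides q ≡.refl) = begin
    (q ℕ.* p) · x               ≈⟨ ·≈·1* (q ℕ.* p) x ⟩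
    ((q ℕ.* p) · 1#) * x        ≈⟨ *-congʳ (×1-homo-* q p) ⟩
    ((q · 1#) * (p · 1#)) * x   ≈⟨ *-congʳ (*-congˡ p·1≈0) ⟩
    ((q · 1#) * 0#) * x         ≈⟨ *-congʳ (zeroʳ _) ⟩
    0# * x                      ≈⟨ zeroˡ x ⟩
    0#                          ∎

  binomial-extremes : ∀ q x y → (∀ (i : Fin q) → binomialTerm x y (suc q) (1+ (inject₁ i)) ≈ 0#)
                    → (x + y) ^ suc q ≈ x ^ suc q + y ^ suc q
  binomial-extremes q x y middle≈0 = begin
    (x + y) ^ suc q                             ≈⟨ theorem (suc q) x y ⟩
    t 0F + sum (λ i → t (1+ i))                 ≈⟨ +-cong first (sum-init-last (λ i → t (1+ i))) ⟩
    y ^ suc q + (sum middle + t (1+ (fromℕ q))) ≈⟨ +-congˡ (+-cong (sum-zero middle middle≈0) last) ⟩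
    y ^ suc q + (0# + x ^ suc q)                ≈⟨ +-congˡ (+-identityˡ _) ⟩
    y ^ suc q + x ^ suc q                       ≈⟨ +-comm _ _ ⟩
    x ^ suc q + y ^ suc q                       ∎
    where
    t : Fin (suc (suc q)) → R
    t = binomialTerm x y (suc q)
    middle : Fin q → R
    middle i = t (1+ (inject₁ i))
    first : t 0F ≈ y ^ suc q
    first = trans (+-identityʳ _) (*-identityˡ _)
    last : t (1+ (fromℕ q)) ≈ x ^ suc q
    last rewrite toℕ-fromℕ q | nCn≡1 (suc q) | ℕ.n∸n≡0 q = trans (+-identityʳ _) (*-identityʳ _)

  frobenius : ∀ {p} → Prime p → p · 1# ≈ 0# → ∀ x y → (x + y) ^ p ≈ x ^ p + y ^ p
  frobenius {suc q} pp p·1≈0 x y = binomial-extremes q x y λ i →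
    ∣⇒·≈0 _ p·1≈0 (p∣pCk pp (s≤s z≤n) (s≤s (≡.subst (_< q) (≡.sym (toℕ-inject₁ i)) (toℕ<n i))))

  frobenius-^ : ∀ {p} → Prime p → p · 1# ≈ 0#
              → ∀ k x y → (x + y) ^ (p ℕ.^ k) ≈ x ^ (p ℕ.^ k) + y ^ (p ℕ.^ k)
  frobenius-^ pp p·1≈0 zero x y = distribʳ 1# x y
  frobenius-^ {p} pp p·1≈0 (suc k) x y = begin
    (x + y) ^ (p ℕ.* pᵏ)            ≈⟨ ^-assocʳ (x + y) p pᵏ ⟨
    ((x + y) ^ p) ^ pᵏ              ≈⟨ ^-congˡ pᵏ (frobenius pp p·1≈0 x y) ⟩
    (x ^ p + y ^ p) ^ pᵏ            ≈⟨ frobenius-^ pp p·1≈0 k (x ^ p) (y ^ p) ⟩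
    (x ^ p) ^ pᵏ + (y ^ p) ^ pᵏ     ≈⟨ +-cong (^-assocʳ x p pᵏ) (^-assocʳ y p pᵏ) ⟩
    x ^ (p ℕ.* pᵏ) + y ^ (p ℕ.* pᵏ) ∎
    where
    pᵏ : ℕ
    pᵏ = p ℕ.^ k

module FieldFacts {a ℓ} (K : CommutativeRing a ℓ) (isField : Poly.IsField K) where

  open import Data.Nat.Base as ℕ using (suc; s≤s; z≤n)
  import Data.Nat.Properties as ℕ
  open import Data.Product using (_,_; proj₁; proj₂)
  open import Relation.Nullary.Negation using (Stable)
  import Relation.Binary.PropositionalEquality as ≡

  open CommutativeRing K renaming (Carrier to R)
  open import Algebra.Properties.Ring ring using (x[y-z]≈xy-xz)
  open import Algebra.Properties.Group +-group using (x∙y⁻¹≈ε⇒x≈y)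
  open import Algebra.Properties.Semiring.Exp semiring using (_^_; ^-homo-*)
  open import Relation.Binary.Reasoning.Setoid setoid

  1≉0 : 1# ≉ 0#
  1≉0 = proj₁ isField

  *≈0⇒≈0 : ∀ {x y} → x * y ≈ 0# → y ≉ 0# → x ≈ 0#
  *≈0⇒≈0 {x} {y} xy≈0 y≉0 = let y⁻¹ , yy⁻¹≈1 = proj₂ isField y y≉0 in begin
    x               ≈⟨ *-identityʳ x ⟨
    x * 1#          ≈⟨ *-congˡ yy⁻¹≈1 ⟨
    x * (y * y⁻¹)   ≈⟨ *-assoc x y y⁻¹ ⟨
    (x * y) * y⁻¹   ≈⟨ *-congʳ xy≈0 ⟩
    0# * y⁻¹        ≈⟨ zeroˡ y⁻¹ ⟩
    0#              ∎

  *-nonzero : ∀ {x y} → x ≉ 0# → y ≉ 0# → x * y ≉ 0#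
  *-nonzero x≉0 y≉0 xy≈0 = x≉0 (*≈0⇒≈0 xy≈0 y≉0)

  -- e = x^(Q-1) is an idempotent with x ≈ x e. Under ¬¬ (x ≈ 0) we get 1 - e ≉ 0, and then
  -- e (1 - e) ≈ 0 forces e ≈ 0.
  power-fixed⇒≈0-stable : ∀ {Q} → 2 ≤ Q → (∀ x → x ^ Q ≈ x) → ∀ x → Stable (x ≈ 0#)
  power-fixed⇒≈0-stable {suc (suc m)} (s≤s (s≤s z≤n)) fixed x ¬¬x≈0 = begin
    x         ≈⟨ fixed x ⟨
    x * e     ≈⟨ *-congˡ e≈0 ⟩
    x * 0#    ≈⟨ zeroʳ x ⟩
    0#        ∎
    where
    e : R
    e = x ^ suc m
    e*e≈e : e * e ≈ e
    e*e≈e = begin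
      e * e                       ≈⟨ ^-homo-* x (suc m) (suc m) ⟨
      x ^ (suc m ℕ.+ suc m)       ≡⟨ ≡.cong (x ^_) (ℕ.+-suc (suc m) m) ⟩
      x ^ (suc (suc m) ℕ.+ m)     ≈⟨ ^-homo-* x (suc (suc m)) m ⟩
      x ^ suc (suc m) * x ^ m     ≈⟨ *-congʳ (fixed x) ⟩
      e                           ∎
    1-e≉0 : 1# - e ≉ 0#
    1-e≉0 1-e≈0 = ¬¬x≈0 λ x≈0 → 1≉0 (begin
      1#          ≈⟨ x∙y⁻¹≈ε⇒x≈y 1# e 1-e≈0 ⟩
      e           ≈⟨ *-congʳ x≈0 ⟩
      0# * x ^ m  ≈⟨ zeroˡ _ ⟩
      0#          ∎)
    e≈0 : e ≈ 0#
    e≈0 = *≈0⇒≈0 (begin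
      e * (1# - e)        ≈⟨ x[y-z]≈xy-xz e 1# e ⟩
      e * 1# - e * e      ≈⟨ +-cong (*-identityʳ e) (-‿cong e*e≈e) ⟩
      e - e               ≈⟨ -‿inverseʳ e ⟩
      0#                  ∎) 1-e≉0

module FpMuD {a ℓ} (K : CommutativeRing a ℓ) where

  open import Data.Nat.Base as ℕ using (suc; NonZero)
  import Data.Nat.Properties as ℕ
  open import Data.Nat.Divisibility using (n∣m*n)
  open import Data.Nat.DivMod using (_%_; _/_; _mod_; m≡m%n+[m/n]*n; m%n<n)
  open import Data.Nat.Primality using (prime⇒nonZero; prime⇒nonTrivial)
  open import Data.Fin.Base using (Fin; toℕ; punchIn)
  open import Data.Fin.Properties using (toℕ-fromℕ<; punchInᵢ≢i)
  open import Data.List.Base using ([]; _∷_; map; allFin)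
  import Data.List.Relation.Unary.Any as Any
  import Data.List.Relation.Unary.Any.Properties as Any
  open import Data.List.Membership.Propositional.Properties using (∈-allFin)
  open import Data.List.Relation.Unary.Enumerates.Setoid using (IsEnumeration)
  open import Data.Vec.Functional using (updateAt; removeAt)
  open import Data.Vec.Functional.Properties using (updateAt-updates; updateAt-minimal)
  open import Data.Product using (_,_)
  open import Relation.Binary.PropositionalEquality as ≡ using (_≡_)

  open CommutativeRing K renaming (Carrier to R)
  open Poly K using (pow; sumL; IsFpMuD; HasCharacteristic)
  open import Algebra.Properties.Semiring.Exp semiring using (_^_; ^-congˡ; ^-assocʳ)
  open import Algebra.Properties.Semiring.Mult semiring using (×-homo-+) renaming (_×_ to _·_)
  open import Algebra.Properties.Semiring.Sum semiring using (sum; sum-syntax; sum-cong-≋; sum-remove)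
  open import Relation.Binary.Reasoning.Setoid setoid
  open Arithmetic using (prime-power≡1-mod)
  open Enumeration using (allFunctions; allFunctions⁺)
  open Frobenius K using (pow≡^; 1#^; 0#^; sum-zero; ∣⇒·≈0; characteristic⇒p·1≈0; frobenius-^)

  root-of-unity-^ : ∀ {d} {ζ : R} → pow ζ d ≈ 1# → ∀ r → ζ ^ (1 ℕ.+ r ℕ.* d) ≈ ζ
  root-of-unity-^ {d} {ζ} ζᵈ≈1 r = begin
    ζ * ζ ^ (r ℕ.* d)   ≡⟨ ≡.cong (λ n → ζ * ζ ^ n) (ℕ.*-comm r d) ⟩
    ζ * ζ ^ (d ℕ.* r)   ≈⟨ *-congˡ (^-assocʳ ζ d r) ⟨
    ζ * (ζ ^ d) ^ r     ≈⟨ *-congˡ (^-congˡ r (trans (reflexive (≡.sym (pow≡^ ζ d))) ζᵈ≈1)) ⟩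
    ζ * 1# ^ r          ≈⟨ *-congˡ (1#^ r) ⟩
    ζ * 1#              ≈⟨ *-identityʳ ζ ⟩
    ζ                   ∎

  additive-power-fixes-sums : ∀ {n} Q .{{_ : NonZero Q}} → (∀ x y → (x + y) ^ Q ≈ x ^ Q + y ^ Q)
                            → (ζ : Fin n → R) → (∀ i → ζ i ^ Q ≈ ζ i)
                            → ∀ l → sumL (map ζ l) ^ Q ≈ sumL (map ζ l)
  additive-power-fixes-sums Q additive ζ ζ-fixed [] = 0#^ Q
  additive-power-fixes-sums Q additive ζ ζ-fixed (i ∷ l) =
    trans (additive (ζ i) (sumL (map ζ l)))
          (+-cong (ζ-fixed i) (additive-power-fixes-sums Q additive ζ ζ-fixed l))

  -- Q = pᵏ⁺¹ ≡ 1 (mod d): x ↦ x^Q is additive and fixes μ_d, which generates K additively.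
  Fp[μd]-power-fixes : ∀ {d p} .{{_ : NonZero d}} → Prime p → HasCharacteristic p → ¬ p ∣ d
                     → IsFpMuD d → ∃ λ Q → 2 ≤ Q × ∀ x → x ^ Q ≈ x
  Fp[μd]-power-fixes {d} {p} pp char p∤d (ζ , ζᵈ≈1 , _ , generated)
    with k , r , Q≡1+rd ← prime-power≡1-mod d p pp p∤d =
    Q , 2≤Q , λ x → let l , x≈Σl = generated x in begin
      x ^ Q                 ≈⟨ ^-congˡ Q x≈Σl ⟩
      sumL (map ζ l) ^ Q    ≈⟨ additive-power-fixes-sums Q additive ζ ζ-fixed l ⟩
      sumL (map ζ l)        ≈⟨ x≈Σl ⟨
      x                     ∎
    where
    instance
      _ = prime⇒nonTrivial pp
      _ = prime⇒nonZero pp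
      _ = ℕ.m^n≢0 p k
      _ = ℕ.m^n≢0 p (suc k)
    Q : ℕ
    Q = p ℕ.^ suc k
    additive : ∀ x y → (x + y) ^ Q ≈ x ^ Q + y ^ Q
    additive = frobenius-^ pp (characteristic⇒p·1≈0 p char) (suc k)
    ζ-fixed : ∀ i → ζ i ^ Q ≈ ζ i
    ζ-fixed i = trans (reflexive (≡.cong (ζ i ^_) Q≡1+rd)) (root-of-unity-^ (ζᵈ≈1 i) r)
    2≤Q : 2 ≤ Q
    2≤Q = ℕ.≤-trans (ℕ.nonTrivial⇒n>1 p) (ℕ.m≤m*n p (p ℕ.^ k))

  multiplicities : ∀ {n} → List (Fin n) → Fin n → ℕ
  multiplicities [] _ = 0
  multiplicities (i ∷ l) = updateAt (multiplicities l) i suc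

  ∑-updateAt-suc : ∀ {n} (m : Fin n → ℕ) (ζ : Fin n → R) i
                 → ∑[ j < n ] (updateAt m i suc j · ζ j) ≈ ζ i + ∑[ j < n ] (m j · ζ j)
  ∑-updateAt-suc {suc n} m ζ i = begin
    sum t′                           ≈⟨ sum-remove t′ ⟩
    t′ i + sum (removeAt t′ i)       ≈⟨ +-cong (reflexive t′ᵢ≡) (sum-cong-≋ removeAt-t′≋) ⟩
    (ζ i + t i) + sum (removeAt t i) ≈⟨ +-assoc (ζ i) (t i) _ ⟩
    ζ i + (t i + sum (removeAt t i)) ≈⟨ +-congˡ (sum-remove t) ⟨
    ζ i + sum t                      ∎
    where
    t t′ : Fin (suc n) → R
    t j = m j · ζ j
    t′ j = updateAt m i suc j · ζ j
    t′ᵢ≡ : t′ i ≡ ζ i + t i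
    t′ᵢ≡ = ≡.cong (_· ζ i) (updateAt-updates i m)
    removeAt-t′≋ : ∀ j → removeAt t′ i j ≈ removeAt t i j
    removeAt-t′≋ j =
      reflexive (≡.cong (_· ζ (punchIn i j)) (updateAt-minimal (punchIn i j) i m (punchInᵢ≢i i j)))

  sumL≈∑multiplicities : ∀ {n} (ζ : Fin n → R) l
                       → sumL (map ζ l) ≈ ∑[ j < n ] (multiplicities l j · ζ j)
  sumL≈∑multiplicities ζ [] = sym (sum-zero (λ j → 0 · ζ j) (λ _ → refl))
  sumL≈∑multiplicities ζ (i ∷ l) =
    trans (+-congˡ (sumL≈∑multiplicities ζ l)) (sym (∑-updateAt-suc (multiplicities l) ζ i))

  ·≈%· : ∀ {p} .{{_ : NonZero p}} → p · 1# ≈ 0# → ∀ n x → n · x ≈ (n % p) · x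
  ·≈%· {p} p·1≈0 n x = begin
    n · x                           ≡⟨ ≡.cong (_· x) (m≡m%n+[m/n]*n n p) ⟩
    (n % p ℕ.+ n / p ℕ.* p) · x     ≈⟨ ×-homo-+ x (n % p) _ ⟩
    (n % p) · x + (n / p ℕ.* p) · x ≈⟨ +-congˡ (∣⇒·≈0 x p·1≈0 (n∣m*n (n / p))) ⟩
    (n % p) · x + 0#                ≈⟨ +-identityʳ _ ⟩
    (n % p) · x                     ∎

  sumL≈∑multiplicities-mod : ∀ {n p} .{{_ : NonZero p}} → p · 1# ≈ 0# → (ζ : Fin n → R) → ∀ l
                           → sumL (map ζ l) ≈ ∑[ j < n ] (toℕ (multiplicities l j mod p) · ζ j)
  sumL≈∑multiplicities-mod {n} {p} p·1≈0 ζ l = begin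
    sumL (map ζ l)                                ≈⟨ sumL≈∑multiplicities ζ l ⟩
    ∑[ j < n ] (multiplicities l j · ζ j)         ≈⟨ sum-cong-≋ (λ j → ·≈%· p·1≈0 _ (ζ j)) ⟩
    ∑[ j < n ] ((multiplicities l j % p) · ζ j)   ≈⟨ sum-cong-≋ (λ j → reflexive (≡.cong (_· ζ j) (toℕ-mod j))) ⟨
    ∑[ j < n ] (toℕ (multiplicities l j mod p) · ζ j) ∎
    where
    toℕ-mod : ∀ j → toℕ (multiplicities l j mod p) ≡ multiplicities l j % p
    toℕ-mod j = toℕ-fromℕ< (m%n<n (multiplicities l j) p)

  Fp[μd]-finite : ∀ {d p} .{{_ : NonZero p}} → HasCharacteristic p → IsFpMuD d
                → ∃ (IsEnumeration setoid)
  Fp[μd]-finite {d} {p} char (ζ , _ , _ , generated) = map value coefficients , enumerates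
    where
    value : (Fin d → Fin p) → R
    value c = ∑[ j < d ] (toℕ (c j) · ζ j)
    coefficients : List (Fin d → Fin p)
    coefficients = allFunctions (allFin p) d
    value-cong : ∀ {c c′} → (∀ j → c j ≡ c′ j) → value c ≈ value c′
    value-cong c≡c′ = sum-cong-≋ (λ j → reflexive (≡.cong (λ cⱼ → toℕ cⱼ · ζ j) (c≡c′ j)))
    enumerates : IsEnumeration setoid (map value coefficients)
    enumerates x =
      let l , x≈Σl = generated x
          x≈value = trans x≈Σl (sumL≈∑multiplicities-mod (characteristic⇒p·1≈0 p char) ζ l)
      in Any.map⁺ (Any.map (λ c≡c′ → trans x≈value (value-cong c≡c′))
                           (allFunctions⁺ (≡.setoid (Fin p)) ∈-allFin d (λ j → multiplicities l j mod p)))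

module Polynomials {a ℓ} (K : CommutativeRing a ℓ) where

  open import Data.Nat.Base as ℕ using (zero; suc; _∸_; _<_; s≤s)
  import Data.Nat.Properties as ℕ
  open import Data.Product using (_,_)
  open import Data.Sum as Sum using (_⊎_; inj₁; inj₂)
  open import Relation.Nullary using (yes; no)
  open import Relation.Nullary.Negation using (contradiction)
  open import Function.Base using (_∘_)
  open import Relation.Binary.PropositionalEquality as ≡ using (_≢_)

  open CommutativeRing K renaming (Carrier to R)
  open Poly K
  open import Relation.Binary.Reasoning.Setoid setoid

  sumTo-zero : ∀ n {f} → (∀ k → k < n → f k ≈ 0#) → sumTo n f ≈ 0#
  sumTo-zero zero f≈0 = refl
  sumTo-zero (suc n) f≈0 =
    trans (+-cong (f≈0 n (ℕ.n<1+n n)) (sumTo-zero n (λ k k<n → f≈0 k (ℕ.m<n⇒m<1+n k<n))))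
          (+-identityʳ 0#)

  sumTo-single : ∀ n {f} k → k < n → (∀ i → i < n → i ≢ k → f i ≈ 0#) → sumTo n f ≈ f k
  sumTo-single (suc n) k k<1+n f≈0 with n ℕ.≟ k
  ... | yes ≡.refl =
    trans (+-congˡ (sumTo-zero n (λ i i<n → f≈0 i (ℕ.m<n⇒m<1+n i<n) (ℕ.<⇒≢ i<n)))) (+-identityʳ _)
  ... | no n≢k =
    trans (+-cong (f≈0 n (ℕ.n<1+n n) n≢k)
                  (sumTo-single n k (ℕ.≤∧≢⇒< (ℕ.s≤s⁻¹ k<1+n) (n≢k ∘ ≡.sym))
                                (λ i i<n → f≈0 i (ℕ.m<n⇒m<1+n i<n))))
          (+-identityˡ _)

  *P-zero : ∀ g h i j → (∀ s t → s ≤ i → t ≤ j → g s t * h (i ∸ s) (j ∸ t) ≈ 0#)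
          → (g *P h) i j ≈ 0#
  *P-zero g h i j terms≈0 =
    sumTo-zero (suc i) λ s s≤i → sumTo-zero (suc j) λ t t≤j → terms≈0 s t (ℕ.s≤s⁻¹ s≤i) (ℕ.s≤s⁻¹ t≤j)

  *P-single : ∀ g h {i j} s₀ t₀ → s₀ ≤ i → t₀ ≤ j
            → (∀ s t → s ≤ i → t ≤ j → s ≢ s₀ ⊎ t ≢ t₀ → g s t * h (i ∸ s) (j ∸ t) ≈ 0#)
            → (g *P h) i j ≈ g s₀ t₀ * h (i ∸ s₀) (j ∸ t₀)
  *P-single g h {i} {j} s₀ t₀ s₀≤i t₀≤j others≈0 =
    trans (sumTo-single (suc i) s₀ (s≤s s₀≤i) λ s s<1+i s≢s₀ →
             sumTo-zero (suc j) λ t t<1+j → others≈0 s t (ℕ.s≤s⁻¹ s<1+i) (ℕ.s≤s⁻¹ t<1+j) (inj₁ s≢s₀))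
          (sumTo-single (suc j) t₀ (s≤s t₀≤j) λ t t<1+j t≢t₀ →
             others≈0 s₀ t s₀≤i (ℕ.s≤s⁻¹ t<1+j) (inj₂ t≢t₀))

  mono-≡ : ∀ k l → mono k l k l ≈ 1#
  mono-≡ k l with k ℕ.≟ k | l ℕ.≟ l
  ... | yes _   | yes _   = refl
  ... | no k≢k  | _       = contradiction ≡.refl k≢k
  ... | yes _   | no l≢l  = contradiction ≡.refl l≢l

  mono-≢ : ∀ k l i j → i ≢ k ⊎ j ≢ l → mono k l i j ≈ 0#
  mono-≢ k l i j i≢k⊎j≢l with i ℕ.≟ k | j ℕ.≟ l
  mono-≢ k l i j (inj₁ i≢k) | yes i≡k | yes _   = contradiction i≡k i≢k
  mono-≢ k l i j (inj₂ j≢l) | yes _   | yes j≡l = contradiction j≡l j≢l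
  ... | yes _ | no _ = refl
  ... | no _  | _    = refl

  *P-identityʳ : ∀ g → (g *P oneP) ≈P g
  *P-identityʳ g i j = begin
    (g *P oneP) i j              ≈⟨ *P-single g oneP i j ℕ.≤-refl ℕ.≤-refl others≈0 ⟩
    g i j * oneP (i ∸ i) (j ∸ j) ≡⟨ ≡.cong₂ (λ u v → g i j * oneP u v) (ℕ.n∸n≡0 i) (ℕ.n∸n≡0 j) ⟩
    g i j * oneP 0 0             ≈⟨ *-congˡ (mono-≡ 0 0) ⟩
    g i j * 1#                   ≈⟨ *-identityʳ _ ⟩
    g i j                        ∎
    where
    ∸≢0 : ∀ {s i} → s ≤ i → s ≢ i → i ∸ s ≢ 0
    ∸≢0 s≤i s≢i i∸s≡0 = s≢i (ℕ.≤-antisym s≤i (ℕ.m∸n≡0⇒m≤n i∸s≡0))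
    others≈0 : ∀ s t → s ≤ i → t ≤ j → s ≢ i ⊎ t ≢ j → g s t * oneP (i ∸ s) (j ∸ t) ≈ 0#
    others≈0 s t s≤i t≤j s≢i⊎t≢j =
      trans (*-congˡ (mono-≢ 0 0 (i ∸ s) (j ∸ t) (Sum.map (∸≢0 s≤i) (∸≢0 t≤j) s≢i⊎t≢j))) (zeroʳ _)

  oneP-isPoly : IsPoly oneP
  oneP-isPoly = 1 , λ where
    zero zero ()
    zero (suc j) _ → mono-≢ 0 0 0 (suc j) (inj₂ λ ())
    (suc i) j _ → mono-≢ 0 0 (suc i) j (inj₁ λ ())

  ≈P⇒Associated : ∀ {g h} → g ≈P h → Associated g h
  ≈P⇒Associated {g} {h} g≈h = (oneP , oneP-isPoly , λ i j → trans (*P-identityʳ g i j) (g≈h i j))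
                            , (oneP , oneP-isPoly , λ i j → trans (*P-identityʳ h i j) (sym (g≈h i j)))

module WeightedDegree {a ℓ} (K : CommutativeRing a ℓ) (d : ℕ) where

  open import Data.Nat.Base as ℕ using (zero; suc; _∸_; _<_; z≤n)
  import Data.Nat.Properties as ℕ
  open import Data.Nat.Tactic.RingSolver using (solve-∀)
  open import Data.Sum using (_⊎_; inj₁; inj₂)
  open import Relation.Nullary using (yes; no)
  open import Relation.Nullary.Negation using (contradiction)
  open import Relation.Binary.Definitions using (tri<; tri≈; tri>)
  open import Relation.Binary.PropositionalEquality as ≡ using (_≡_; _≢_)

  open CommutativeRing K renaming (Carrier to R)
  open Poly K
  open Polynomials K
  open import Algebra.Properties.Group +-group using (ε⁻¹≈ε)
  open import Algebra.Properties.Semiring.Exp semiring using (_^_; ^-congˡ)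
  open import Relation.Binary.Reasoning.Setoid setoid
  open Arithmetic using (+-<⇒<⊎<)
  open Frobenius K using (1#^)

  -- z has weight 1 and c weight d, so that z^d + c is weighted homogeneous.
  weight : ℕ → ℕ → ℕ
  weight i j = i ℕ.+ d ℕ.* j

  WeightAtMost : Coeff → ℕ → Set ℓ
  WeightAtMost g w = ∀ i j → w < weight i j → g i j ≈ 0#

  weight-+ : ∀ i j k l → weight i j ℕ.+ weight k l ≡ weight (i ℕ.+ k) (j ℕ.+ l)
  weight-+ = interchange d
    where
    interchange : ∀ n i j k l → (i ℕ.+ n ℕ.* j) ℕ.+ (k ℕ.+ n ℕ.* l) ≡ (i ℕ.+ k) ℕ.+ n ℕ.* (j ℕ.+ l)
    interchange = solve-∀

  weight-∸ : ∀ {s t i j} → s ≤ i → t ≤ j → weight s t ℕ.+ weight (i ∸ s) (j ∸ t) ≡ weight i j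
  weight-∸ {s} {t} {i} {j} s≤i t≤j =
    ≡.trans (weight-+ s t (i ∸ s) (j ∸ t)) (≡.cong₂ weight (ℕ.m+[n∸m]≡n s≤i) (ℕ.m+[n∸m]≡n t≤j))

  weight-i0 : ∀ i → weight i 0 ≡ i
  weight-i0 i = ≡.trans (≡.cong (i ℕ.+_) (ℕ.*-zeroʳ d)) (ℕ.+-identityʳ i)

  WeightAtMost-weaken : ∀ {g v w} → v ≤ w → WeightAtMost g v → WeightAtMost g w
  WeightAtMost-weaken v≤w g≤v i j w<ij = g≤v i j (ℕ.≤-<-trans v≤w w<ij)

  mono-weight : ∀ k l → WeightAtMost (mono k l) (weight k l)
  mono-weight k l i j kl<ij = mono-≢ k l i j (≢-pos i j kl<ij)
    where
    ≢-pos : ∀ i j → weight k l < weight i j → i ≢ k ⊎ j ≢ l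
    ≢-pos i j kl<ij with i ℕ.≟ k
    ... | no i≢k = inj₁ i≢k
    ... | yes ≡.refl = inj₂ λ { ≡.refl → ℕ.<-irrefl ≡.refl kl<ij }

  +P-weight : ∀ {g h w} → WeightAtMost g w → WeightAtMost h w → WeightAtMost (g +P h) w
  +P-weight g≤w h≤w i j w<ij = trans (+-cong (g≤w i j w<ij) (h≤w i j w<ij)) (+-identityʳ 0#)

  -P-weight : ∀ {g h w} → WeightAtMost g w → WeightAtMost h w → WeightAtMost (g -P h) w
  -P-weight g≤w h≤w i j w<ij =
    trans (+-cong (g≤w i j w<ij) (trans (-‿cong (h≤w i j w<ij)) ε⁻¹≈ε)) (+-identityʳ 0#)

  *P-weight : ∀ {g h v w} → WeightAtMost g v → WeightAtMost h w → WeightAtMost (g *P h) (v ℕ.+ w)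
  *P-weight {g} {h} {v} {w} g≤v h≤w i j v+w<ij = *P-zero g h i j term≈0
    where
    term≈0 : ∀ s t → s ≤ i → t ≤ j → g s t * h (i ∸ s) (j ∸ t) ≈ 0#
    term≈0 s t s≤i t≤j with +-<⇒<⊎< (≡.subst (v ℕ.+ w <_) (≡.sym (weight-∸ s≤i t≤j)) v+w<ij)
    ... | inj₁ v<st = trans (*-congʳ (g≤v s t v<st)) (zeroˡ _)
    ... | inj₂ w<rest = trans (*-congˡ (h≤w _ _ w<rest)) (zeroʳ _)

  ^P-weight : ∀ {g w} n → WeightAtMost g w → WeightAtMost (g ^P n) (n ℕ.* w)
  ^P-weight zero g≤w = WeightAtMost-weaken (ℕ.≤-reflexive (weight-i0 0)) (mono-weight 0 0)
  ^P-weight (suc n) g≤w = *P-weight g≤w (^P-weight n g≤w)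

  *P-top : ∀ {g h v w} → WeightAtMost g v → WeightAtMost h w → (g *P h) (v ℕ.+ w) 0 ≈ g v 0 * h w 0
  *P-top {g} {h} {v} {w} g≤v h≤w = begin
    (g *P h) (v ℕ.+ w) 0              ≈⟨ *P-single g h v 0 (ℕ.m≤m+n v w) z≤n others≈0 ⟩
    g v 0 * h (v ℕ.+ w ∸ v) 0         ≡⟨ ≡.cong (λ k → g v 0 * h k 0) (ℕ.m+n∸m≡n v w) ⟩
    g v 0 * h w 0                     ∎
    where
    <-weight-i0 : ∀ {m i} → m < i → m < weight i 0
    <-weight-i0 {m} {i} m<i = ≡.subst (m <_) (≡.sym (weight-i0 i)) m<i
    others≈0 : ∀ s t → s ≤ v ℕ.+ w → t ≤ 0 → s ≢ v ⊎ t ≢ 0 → g s t * h (v ℕ.+ w ∸ s) (0 ∸ t) ≈ 0#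
    others≈0 s zero _ _ (inj₂ 0≢0) = contradiction ≡.refl 0≢0
    others≈0 s zero s≤v+w _ (inj₁ s≢v) with ℕ.<-cmp s v
    ... | tri≈ _ s≡v _ = contradiction s≡v s≢v
    ... | tri> _ _ v<s = trans (*-congʳ (g≤v s 0 (<-weight-i0 v<s))) (zeroˡ _)
    ... | tri< s<v _ _ = trans (*-congˡ (h≤w (v ℕ.+ w ∸ s) 0 (<-weight-i0 w<v+w∸s))) (zeroʳ _)
      where
      w<v+w∸s : w < v ℕ.+ w ∸ s
      w<v+w∸s = ℕ.+-cancelˡ-< s w (v ℕ.+ w ∸ s)
                  (≡.subst (s ℕ.+ w <_) (≡.sym (ℕ.m+[n∸m]≡n s≤v+w)) (ℕ.+-monoˡ-< w s<v))

  ^P-top : ∀ {g w} n → WeightAtMost g w → (g ^P n) (n ℕ.* w) 0 ≈ g w 0 ^ n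
  ^P-top zero g≤w = mono-≡ 0 0
  ^P-top (suc n) g≤w = trans (*P-top g≤w (^P-weight n g≤w)) (*-congˡ (^P-top n g≤w))

  module _ (1≤d : 1 ≤ d) where

    iter-weight : ∀ n → WeightAtMost (iter d n) (d ℕ.^ n)
    iter-weight zero = WeightAtMost-weaken (ℕ.≤-reflexive (weight-i0 1)) (mono-weight 1 0)
    iter-weight (suc n) = +P-weight (^P-weight d (iter-weight n))
                                          (WeightAtMost-weaken weight-C≤ (mono-weight 0 1))
      where
      weight-C≤ : weight 0 1 ≤ d ℕ.* d ℕ.^ n
      weight-C≤ = ℕ.*-monoʳ-≤ d (ℕ.m^n>0 d ⦃ ℕ.>-nonZero 1≤d ⦄ n)

    iter-top : ∀ n → iter d n (d ℕ.^ n) 0 ≈ 1#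
    iter-top zero = mono-≡ 1 0
    iter-top (suc n) = begin
      (iter d n ^P d) (d ℕ.* d ℕ.^ n) 0 + C (d ℕ.^ suc n) 0
        ≈⟨ +-cong (^P-top d (iter-weight n)) (mono-≢ 0 1 (d ℕ.^ suc n) 0 (inj₂ λ ())) ⟩
      iter d n (d ℕ.^ n) 0 ^ d + 0#  ≈⟨ +-identityʳ _ ⟩
      iter d n (d ℕ.^ n) 0 ^ d       ≈⟨ ^-congˡ d (iter-top n) ⟩
      1# ^ d                         ≈⟨ 1#^ d ⟩
      1#                             ∎

  module _ (2≤d : 2 ≤ d) {m n} (m<n : m < n) where

    private
      dᵐ<dⁿ : d ℕ.^ m < d ℕ.^ n
      dᵐ<dⁿ = ℕ.^-monoʳ-< d 2≤d m<n

    dynatomic-weight : WeightAtMost (iter d n -P iter d m) (d ℕ.^ n)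
    dynatomic-weight = -P-weight (iter-weight (ℕ.<⇒≤ 2≤d) n)
                                       (WeightAtMost-weaken (ℕ.<⇒≤ dᵐ<dⁿ) (iter-weight (ℕ.<⇒≤ 2≤d) m))

    dynatomic-top : (iter d n -P iter d m) (d ℕ.^ n) 0 ≈ 1#
    dynatomic-top = begin
      iter d n (d ℕ.^ n) 0 - iter d m (d ℕ.^ n) 0
        ≈⟨ +-cong (iter-top (ℕ.<⇒≤ 2≤d) n) (-‿cong (iter-weight (ℕ.<⇒≤ 2≤d) m _ 0 dᵐ<weight)) ⟩
      1# - 0#  ≈⟨ +-congˡ ε⁻¹≈ε ⟩
      1# + 0#  ≈⟨ +-identityʳ 1# ⟩
      1#       ∎
      where
      dᵐ<weight : d ℕ.^ m < weight (d ℕ.^ n) 0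
      dᵐ<weight = ≡.subst (d ℕ.^ m <_) (≡.sym (weight-i0 _)) dᵐ<dⁿ

module LeadingMonomials {a ℓ} (K : CommutativeRing a ℓ) (d : ℕ) (1≤d : 1 ≤ d) where

  open import Data.Nat.Base as ℕ using (suc; _∸_; _<_; s≤s)
  import Data.Nat.Properties as ℕ
  open import Data.Nat.Tactic.RingSolver using (solve-∀)
  open import Data.Empty using (⊥)
  open import Data.Product using (_,_; ∃₂; proj₂; uncurry)
  open import Data.Sum using (_⊎_; inj₁; inj₂)
  open import Relation.Nullary using (yes; no)
  open import Relation.Nullary.Negation using (contradiction; Stable; ¬¬-map)
  open import Relation.Binary.Definitions using (tri<; tri≈; tri>)
  open import Relation.Binary.PropositionalEquality as ≡ using (_≡_; _≢_)

  open CommutativeRing K renaming (Carrier to R)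
  open Poly K
  open Polynomials K
  open WeightedDegree K d
  open Arithmetic using (+-<⇒<⊎<; ¬¬-maximal)

  instance
    _ = ℕ.>-nonZero 1≤d

  -- For z-degrees below B, rank orders monomials lexicographically: by weight, then by z-degree.
  module Ranked (B : ℕ) where

    rank : ℕ → ℕ → ℕ
    rank i j = weight i j ℕ.* B ℕ.+ i

    rank-+ : ∀ i j k l → rank i j ℕ.+ rank k l ≡ rank (i ℕ.+ k) (j ℕ.+ l)
    rank-+ i j k l = ≡.trans (regroup (weight i j) (weight k l) B i k)
                             (≡.cong (λ w → w ℕ.* B ℕ.+ (i ℕ.+ k)) (weight-+ i j k l))
      where
      regroup : ∀ v w n i k → (v ℕ.* n ℕ.+ i) ℕ.+ (w ℕ.* n ℕ.+ k) ≡ (v ℕ.+ w) ℕ.* n ℕ.+ (i ℕ.+ k)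
      regroup = solve-∀

    rank-∸ : ∀ {s t i j} → s ≤ i → t ≤ j → rank s t ℕ.+ rank (i ∸ s) (j ∸ t) ≡ rank i j
    rank-∸ {s} {t} {i} {j} s≤i t≤j =
      ≡.trans (rank-+ s t (i ∸ s) (j ∸ t)) (≡.cong₂ rank (ℕ.m+[n∸m]≡n s≤i) (ℕ.m+[n∸m]≡n t≤j))

    rank-mono : ∀ {i j i′ j′} → i ≤ i′ → j ≤ j′ → rank i j ≤ rank i′ j′
    rank-mono i≤i′ j≤j′ = ℕ.+-mono-≤ (ℕ.*-monoˡ-≤ B (ℕ.+-mono-≤ i≤i′ (ℕ.*-monoʳ-≤ d j≤j′))) i≤i′

    rank-≤⇒weight-≤ : ∀ {i j i′ j′} → i′ < B → rank i j ≤ rank i′ j′ → weight i j ≤ weight i′ j′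
    rank-≤⇒weight-≤ {i} {j} {i′} {j′} i′<B r≤r′ with weight i j ℕ.≤? weight i′ j′
    ... | yes w≤w′ = w≤w′
    ... | no w≰w′ = contradiction r≤r′ (ℕ.<⇒≱ (begin-strict
      weight i′ j′ ℕ.* B ℕ.+ i′       <⟨ ℕ.+-monoʳ-< _ i′<B ⟩
      weight i′ j′ ℕ.* B ℕ.+ B        ≡⟨ ℕ.+-comm _ B ⟩
      suc (weight i′ j′) ℕ.* B        ≤⟨ ℕ.*-monoˡ-≤ B (ℕ.≰⇒> w≰w′) ⟩
      weight i j ℕ.* B                ≤⟨ ℕ.m≤m+n _ i ⟩
      rank i j                        ∎))
      where open ℕ.≤-Reasoning

    rank-injective : ∀ {i j i′ j′} → i < B → i′ < B → rank i j ≡ rank i′ j′ → i ≡ i′ × j ≡ j′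
    rank-injective {i} {j} {i′} {j′} i<B i′<B r≡r′ = i≡i′ , j≡j′
      where
      w≡w′ : weight i j ≡ weight i′ j′
      w≡w′ = ℕ.≤-antisym (rank-≤⇒weight-≤ i′<B (ℕ.≤-reflexive r≡r′))
                         (rank-≤⇒weight-≤ i<B (ℕ.≤-reflexive (≡.sym r≡r′)))
      i≡i′ : i ≡ i′
      i≡i′ = ℕ.+-cancelˡ-≡ _ i i′ (≡.trans r≡r′ (≡.cong (λ w → w ℕ.* B ℕ.+ i′) (≡.sym w≡w′)))
      j≡j′ : j ≡ j′
      j≡j′ = ℕ.*-cancelˡ-≡ j j′ d
               (ℕ.+-cancelˡ-≡ i _ _ (≡.trans w≡w′ (≡.cong (λ k → weight k j′) (≡.sym i≡i′))))

    IsLeading : Coeff → ℕ → ℕ → Set ℓ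
    IsLeading g i j = g i j ≉ 0# × (∀ s t → rank i j < rank s t → g s t ≈ 0#)

    leading-≈P : ∀ {g h i j} → g ≈P h → IsLeading g i j → IsLeading h i j
    leading-≈P g≈h (gᵢⱼ≉0 , above≈0) =
      (λ hᵢⱼ≈0 → gᵢⱼ≉0 (trans (g≈h _ _) hᵢⱼ≈0)) , λ s t r<r′ → trans (sym (g≈h s t)) (above≈0 s t r<r′)

    leading-rank-unique : ∀ {g i j i′ j′} → IsLeading g i j → IsLeading g i′ j′ → rank i j ≡ rank i′ j′
    leading-rank-unique {i = i} {j} {i′} {j′} (gᵢⱼ≉0 , above≈0) (gᵢ′ⱼ′≉0 , above′≈0)
      with ℕ.<-cmp (rank i j) (rank i′ j′)
    ... | tri< r<r′ _ _ = contradiction (above≈0 i′ j′ r<r′) gᵢ′ⱼ′≉0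
    ... | tri≈ _ r≡r′ _ = r≡r′
    ... | tri> _ _ r′<r = contradiction (above′≈0 i j r′<r) gᵢⱼ≉0

    -- A monomial of weight ≤ D has rank ≤ D·B + D, since its z-degree is at most its weight.
    top-leading : ∀ {F D} → WeightAtMost F D → F D 0 ≉ 0# → IsLeading F D 0
    top-leading {F} {D} F≤D F-top≉0 = F-top≉0 , above≈0
      where
      above≈0 : ∀ s t → rank D 0 < rank s t → F s t ≈ 0#
      above≈0 s t D0<st with D ℕ.<? weight s t
      ... | yes D<st = F≤D s t D<st
      ... | no D≮st = contradiction D0<st (ℕ.≤⇒≯ (ℕ.+-mono-≤ (ℕ.*-monoˡ-≤ B w≤D) s≤D))
        where
        w≤D : weight s t ≤ weight D 0
        w≤D = ℕ.≤-trans (ℕ.≮⇒≥ D≮st) (ℕ.≤-reflexive (≡.sym (weight-i0 D)))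
        s≤D : s ≤ D
        s≤D = ℕ.≤-trans (ℕ.m≤m+n s (d ℕ.* t)) (ℕ.≮⇒≥ D≮st)

    -- At the sum of the leading exponents only one term of the convolution survives, by injectivity
    -- of rank.
    leading-*P : IsField → ∀ {g h i j k l} → i ℕ.+ k < B → IsLeading g i j → IsLeading h k l
               → IsLeading (g *P h) (i ℕ.+ k) (j ℕ.+ l)
    leading-*P isField {g} {h} {i} {j} {k} {l} i+k<B (gᵢⱼ≉0 , g-above≈0) (hₖₗ≉0 , h-above≈0) =
      product≉0 , above≈0
      where
      open FieldFacts K isField using (*-nonzero)
      I J : ℕ
      I = i ℕ.+ k
      J = j ℕ.+ l
      term-above≈0 : ∀ {u v s t} → rank i j < rank s t ⊎ rank k l < rank (u ∸ s) (v ∸ t)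
                   → g s t * h (u ∸ s) (v ∸ t) ≈ 0#
      term-above≈0 (inj₁ ij<st) = trans (*-congʳ (g-above≈0 _ _ ij<st)) (zeroˡ _)
      term-above≈0 (inj₂ kl<rest) = trans (*-congˡ (h-above≈0 _ _ kl<rest)) (zeroʳ _)
      above≈0 : ∀ u v → rank I J < rank u v → (g *P h) u v ≈ 0#
      above≈0 u v IJ<uv = *P-zero g h u v λ s t s≤u t≤v →
        term-above≈0 (+-<⇒<⊎< (≡.subst₂ _<_ (≡.sym (rank-+ i j k l)) (≡.sym (rank-∸ s≤u t≤v)) IJ<uv))
      others≈0 : ∀ s t → s ≤ I → t ≤ J → s ≢ i ⊎ t ≢ j → g s t * h (I ∸ s) (J ∸ t) ≈ 0#
      others≈0 s t s≤I t≤J st≢ij with ℕ.<-cmp (rank s t) (rank i j)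
      ... | tri> _ _ ij<st = term-above≈0 (inj₁ ij<st)
      ... | tri≈ _ st≡ij _
        with rank-injective (ℕ.≤-<-trans s≤I i+k<B) (ℕ.≤-<-trans (ℕ.m≤m+n i k) i+k<B) st≡ij
      ...   | s≡i , t≡j = contradiction st≢ij λ { (inj₁ s≢i) → s≢i s≡i ; (inj₂ t≢j) → t≢j t≡j }
      others≈0 s t s≤I t≤J st≢ij | tri< st<ij _ _ = term-above≈0 (inj₂ kl<rest)
        where
        kl<rest : rank k l < rank (I ∸ s) (J ∸ t)
        kl<rest = ℕ.≰⇒> λ rest≤kl → ℕ.<-irrefl (≡.trans (rank-∸ s≤I t≤J) (≡.sym (rank-+ i j k l)))
                                                (ℕ.+-mono-<-≤ st<ij rest≤kl)
      product≈ : (g *P h) I J ≈ g i j * h k l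
      product≈ = trans (*P-single g h i j (ℕ.m≤m+n i k) (ℕ.m≤m+n j l) others≈0)
                       (reflexive (≡.cong₂ (λ u v → g i j * h u v) (ℕ.m+n∸m≡n i k) (ℕ.m+n∸m≡n j l)))
      product≉0 : (g *P h) I J ≉ 0#
      product≉0 IJ≈0 = *-nonzero gᵢⱼ≉0 hₖₗ≉0 (trans (sym product≈) IJ≈0)

    leading-exists : (∀ x → Stable (x ≈ 0#)) → ∀ {g i₀ j₀} → IsPoly g → g i₀ j₀ ≉ 0#
                   → ¬ ¬ ∃₂ λ i j → IsLeading g i j × rank i₀ j₀ ≤ rank i j
    leading-exists ≈0-stable {g} {i₀} {j₀} (N , g≈0) g₀≉0 =
      ¬¬-map leading (¬¬-maximal (uncurry rank) NonzeroAt (rank N N) bounded g₀≉0)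
      where
      NonzeroAt : ℕ × ℕ → Set ℓ
      NonzeroAt (i , j) = g i j ≉ 0#
      bounded : ∀ ij → NonzeroAt ij → uncurry rank ij ≤ rank N N
      bounded (i , j) gᵢⱼ≉0 with N ℕ.≤? i ℕ.+ j
      ... | yes N≤i+j = contradiction (g≈0 i j N≤i+j) gᵢⱼ≉0
      ... | no N≰i+j = rank-mono (ℕ.≤-trans (ℕ.m≤m+n i j) i+j≤N) (ℕ.≤-trans (ℕ.m≤n+m j i) i+j≤N)
        where i+j≤N = ℕ.<⇒≤ (ℕ.≰⇒> N≰i+j)
      leading : (∃ λ ij → NonzeroAt ij × rank i₀ j₀ ≤ uncurry rank ij
                         × (∀ st → uncurry rank ij < uncurry rank st → ¬ NonzeroAt st))
              → ∃₂ λ i j → IsLeading g i j × rank i₀ j₀ ≤ rank i j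
      leading ((i , j) , gᵢⱼ≉0 , ij₀≤ij , above) =
        i , j , (gᵢⱼ≉0 , λ s t ij<st → ≈0-stable _ (above (s , t) ij<st)) , ij₀≤ij

  module _ (isField : IsField) (≈0-stable : ∀ x → Stable (x ≈ 0#)) where

    factor-nonzero : ∀ {g h i j} → (g *P h) i j ≉ 0# → ¬ ¬ ∃₂ λ s t → h s t ≉ 0#
    factor-nonzero {g} {h} {i} {j} ghᵢⱼ≉0 no-nonzero = ghᵢⱼ≉0 (*P-zero g h i j λ s t _ _ →
      trans (*-congˡ (≈0-stable _ λ h≉0 → no-nonzero (_ , _ , h≉0))) (zeroʳ _))

    -- The leading monomials of g and h multiply to that of F, which is z^D.
    factor-weight-bound : ∀ {g h F D e} → IsPoly g → IsPoly h → WeightAtMost F D → F D 0 ≉ 0#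
                        → (g *P h) ≈P F → (∀ i j → e < i → g i j ≈ 0#) → WeightAtMost g e
    factor-weight-bound {g} {h} {F} {D} {e} g-poly h-poly@(Nₕ , h≈0) F≤D F-top≉0 gh≈F deg-g≤e
                        i₀ j₀ e<w₀ =
      ≈0-stable _ λ g₀≉0 →
        leading-exists ≈0-stable g-poly g₀≉0 λ { (i , j , g-lead , ij₀≤ij) →
        factor-nonzero {g} {h} {D} {0} gh-top≉0 λ { (s , t , hₛₜ≉0) →
        leading-exists ≈0-stable h-poly hₛₜ≉0 λ { (k , l , h-lead , _) →
        impossible g-lead ij₀≤ij h-lead } } }
      where
      gh-top≉0 : (g *P h) D 0 ≉ 0#
      gh-top≉0 gh≈0 = F-top≉0 (trans (sym (gh≈F D 0)) gh≈0)
      B : ℕ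
      B = suc (e ℕ.+ Nₕ ℕ.+ D)
      open Ranked B
      impossible : ∀ {i j k l} → IsLeading g i j → rank i₀ j₀ ≤ rank i j → IsLeading h k l → ⊥
      impossible {i} {j} {k} {l} g-lead@(gᵢⱼ≉0 , _) ij₀≤ij h-lead@(hₖₗ≉0 , _) = ℕ.<⇒≱ e<w₀ w₀≤e
        where
        i≤e : i ≤ e
        i≤e = ℕ.≮⇒≥ λ e<i → gᵢⱼ≉0 (deg-g≤e i j e<i)
        k<Nₕ : k < Nₕ
        k<Nₕ = ℕ.≰⇒> λ Nₕ≤k → hₖₗ≉0 (h≈0 k l (ℕ.≤-trans Nₕ≤k (ℕ.m≤m+n k l)))
        i+k<B : i ℕ.+ k < B
        i+k<B = s≤s (ℕ.≤-trans (ℕ.+-mono-≤ i≤e (ℕ.<⇒≤ k<Nₕ)) (ℕ.m≤m+n (e ℕ.+ Nₕ) D))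
        D<B : D < B
        D<B = s≤s (ℕ.m≤n+m D (e ℕ.+ Nₕ))
        F-lead : IsLeading F (i ℕ.+ k) (j ℕ.+ l)
        F-lead = leading-≈P gh≈F (leading-*P isField i+k<B g-lead h-lead)
        j+l≡0 : j ℕ.+ l ≡ 0
        j+l≡0 = proj₂ (rank-injective i+k<B D<B
                         (leading-rank-unique F-lead (top-leading F≤D F-top≉0)))
        w₀≤e : weight i₀ j₀ ≤ e
        w₀≤e = begin
          weight i₀ j₀   ≤⟨ rank-≤⇒weight-≤ (ℕ.≤-<-trans (ℕ.m≤m+n i k) i+k<B) ij₀≤ij ⟩
          weight i j     ≡⟨ ≡.cong (weight i) (ℕ.m+n≡0⇒m≡0 j j+l≡0) ⟩
          weight i 0     ≡⟨ weight-i0 i ⟩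
          i              ≤⟨ i≤e ⟩
          e              ∎
          where open ℕ.≤-Reasoning

module Boxes {a ℓ} (K : CommutativeRing a ℓ) where

  open import Data.Nat.Base as ℕ using (suc; s≤s; _<_)
  import Data.Nat.Properties as ℕ
  open import Data.Nat.Properties using (_<?_)
  open import Function.Base using (_∘_)
  open import Data.Fin.Base using (Fin; toℕ; fromℕ<)
  open import Data.Fin.Properties using (toℕ-fromℕ<)
  open import Data.List.Base using (map)
  import Data.List.Relation.Unary.All as All
  import Data.List.Relation.Unary.All.Properties as All
  import Data.List.Relation.Unary.Any as Any
  import Data.List.Relation.Unary.Any.Properties as Any
  open import Data.List.Relation.Unary.Enumerates.Setoid using (IsEnumeration)
  open import Data.Vec.Functional.Relation.Binary.Equality.Setoid using (≋-setoid)
  open import Data.Product using (_,_)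
  open import Data.Sum using (_⊎_; inj₁; inj₂)
  open import Relation.Nullary using (yes; no)
  open import Relation.Nullary.Negation using (contradiction)
  import Relation.Binary.PropositionalEquality as ≡

  open CommutativeRing K renaming (Carrier to R)
  open Poly K
  open Polynomials K using (≈P⇒Associated)
  open Enumeration using (allFunctions; allFunctions⁺)

  Box : ℕ → Set a
  Box e = Fin (suc e) → Fin (suc e) → R

  fromBox : ∀ e → Box e → Coeff
  fromBox e M i j with i <? suc e | j <? suc e
  ... | yes i≤e | yes j≤e = M (fromℕ< i≤e) (fromℕ< j≤e)
  ... | _       | _       = 0#

  fromBox-isPoly : ∀ e M → IsPoly (fromBox e M)
  fromBox-isPoly e M = suc e ℕ.+ suc e , outside≈0
    where
    outside≈0 : ∀ i j → suc e ℕ.+ suc e ≤ i ℕ.+ j → fromBox e M i j ≈ 0#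
    outside≈0 i j 2e+2≤i+j with i <? suc e | j <? suc e
    ... | yes i≤e | yes j≤e = contradiction 2e+2≤i+j (ℕ.<⇒≱ (ℕ.+-mono-< i≤e j≤e))
    ... | yes _   | no _    = refl
    ... | no _    | _       = refl

  fromBox-cong : ∀ e {M M′} → (∀ i j → M i j ≈ M′ i j) → fromBox e M ≈P fromBox e M′
  fromBox-cong e M≈M′ i j with i <? suc e | j <? suc e
  ... | yes _ | yes _ = M≈M′ _ _
  ... | yes _ | no _  = refl
  ... | no _  | _     = refl

  restriction-fromBox : ∀ e g → (∀ i j → e < i ⊎ e < j → g i j ≈ 0#)
                      → g ≈P fromBox e (λ i j → g (toℕ i) (toℕ j))
  restriction-fromBox e g outside≈0 i j with i <? suc e | j <? suc e
  ... | yes i≤e | yes j≤e = reflexive (≡.sym (≡.cong₂ g (toℕ-fromℕ< i≤e) (toℕ-fromℕ< j≤e)))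
  ... | yes _   | no j≰e  = outside≈0 i j (inj₂ (ℕ.≰⇒> (j≰e ∘ s≤s)))
  ... | no i≰e  | _       = outside≈0 i j (inj₁ (ℕ.≰⇒> (i≰e ∘ s≤s)))

  box-polynomials : ∀ {xs} → IsEnumeration setoid xs → ∀ e
                  → ∃ λ (L : List Coeff) → All IsPoly L
                    × (∀ g → (∀ i j → e < i ⊎ e < j → g i j ≈ 0#) → Any (Associated g) L)
  box-polynomials {xs} xs-enum e =
    map (fromBox e) boxes , All.map⁺ (All.universal (fromBox-isPoly e) boxes) , complete
    where
    boxes : List (Box e)
    boxes = allFunctions (allFunctions xs (suc e)) (suc e)
    complete : ∀ g → (∀ i j → e < i ⊎ e < j → g i j ≈ 0#) → Any (Associated g) (map (fromBox e) boxes)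
    complete g outside≈0 = Any.map⁺ (Any.map associated (boxes-enum (λ i j → g (toℕ i) (toℕ j))))
      where
      boxes-enum : IsEnumeration (≋-setoid (≋-setoid setoid (suc e)) (suc e)) boxes
      boxes-enum = allFunctions⁺ (≋-setoid setoid (suc e)) (allFunctions⁺ setoid xs-enum (suc e)) (suc e)
      associated : ∀ {M} → (∀ i j → g (toℕ i) (toℕ j) ≈ M i j) → Associated g (fromBox e M)
      associated g≈M = ≈P⇒Associated λ i j →
        trans (restriction-fromBox e g outside≈0 i j) (fromBox-cong e g≈M i j)

lemma4p3 : ∀ {a ℓ} (d p : ℕ) → 2 ≤ d → Prime p → ¬ (p ∣ d)
    → (K : CommutativeRing a ℓ) → Poly.IsField K
    → Poly.HasCharacteristic K p → Poly.IsFpMuD K d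
    → (e : ℕ) → 1 ≤ e
    → ∃ λ (L : List (Poly.Coeff K)) → All (Poly.IsPoly K) L
      × (∀ g → Poly.IsDynatomic K d g → Poly.DegZ K g e
           → Any (Poly.Associated K g) L)
lemma4p3 d p 2≤d pp p∤d K isField char μd e _ =
  let L , L-poly , box⊆L = Boxes.box-polynomials K (proj₂ (Fp[μd]-finite char μd)) e
  in L , L-poly , λ g g-dynatomic g-deg → box⊆L g (dynatomic-in-box g g-dynatomic g-deg)
  where
  open CommutativeRing K using (_≈_; 0#; sym; trans)
  open Poly K
  open FpMuD K using (Fp[μd]-power-fixes; Fp[μd]-finite)
  open FieldFacts K isField using (1≉0; power-fixed⇒≈0-stable)
  open WeightedDegree K d using (WeightAtMost; dynatomic-weight; dynatomic-top)
  instance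
    _ = ℕ.>-nonZero (ℕ.<⇒≤ 2≤d)
    _ = prime⇒nonZero pp
  open LeadingMonomials K d (ℕ.<⇒≤ 2≤d) using (factor-weight-bound)

  ≈0-stable : ∀ x → Stable (x ≈ 0#)
  ≈0-stable = let _ , 2≤Q , x^Q≈x = Fp[μd]-power-fixes pp char p∤d μd
              in power-fixed⇒≈0-stable 2≤Q x^Q≈x

  dynatomic-in-box : ∀ g → IsDynatomic d g → DegZ g e → ∀ i j → e < i ⊎ e < j → g i j ≈ 0#
  dynatomic-in-box g ((g-poly , _) , n , m , m<n , h , h-poly , gh≈F) (deg≤e , _) = outside≈0
    where
    weight≤e : WeightAtMost g e
    weight≤e = factor-weight-bound isField ≈0-stable g-poly h-poly (dynatomic-weight 2≤d m<n)
                 (λ F-top≈0 → 1≉0 (trans (sym (dynatomic-top 2≤d m<n)) F-top≈0)) gh≈F deg≤e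
    outside≈0 : ∀ i j → e < i ⊎ e < j → g i j ≈ 0#
    outside≈0 i j (inj₁ e<i) = deg≤e i j e<i
    outside≈0 i j (inj₂ e<j) =
      weight≤e i j (ℕ.<-≤-trans e<j (ℕ.≤-trans (ℕ.m≤n*m j d) (ℕ.m≤n+m (d ℕ.* j) i)))
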